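{- Let $(P,\le)$ be a finite partially ordered set and let $I$ be an irreducible upper set of $P$. Then $\chi_I$ is a prime element of $\mathrm{M}(P)$ if and only if: 1. there is $v\in P$ such that $I=\uparrow\{v\}$; 2. if $x\in P\setminus I$ satisfies $\uparrow\{x\}\cap I\ne\emptyset$, then $x\le v$; 3. the set $\{x\in P\setminus I\mid \uparrow\{x\}\cap I\ne\emptyset\}$ is either empty or has a maximum.
   Context: $\uparrow X=\{y\in P\mid x\le y\text{ for some }x\in X\}$; an upper set is $U$ with $\uparrow U=U$; an irreducible upper set is a nonempty upper set that is not the union of two disjoint nonempty upper sets; $\chi_I$ is the indicator function of $I$. $\mathrm{M}(P)$ is the monoid under pointwise addition of monotone functions $P\to\mathbb{N}$; $f\le_{\mathrm{M}(P)}g$ means $g-f\in\mathrm{M}(P)$; $a$ is prime if $a\le_{\mathrm{M}(P)}b+c$ implies $a\le_{\mathrm{M}(P)}b$ or $a\le_{\mathrm{M}(P)}c$. -}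

module Defs where

open import Level using (0ℓ)
open import Data.Nat using (ℕ; _+_) renaming (_≤_ to _≤ℕ_)
open import Data.Fin using (Fin)
open import Data.Bool using (Bool; true; false; if_then_else_)
open import Data.Product using (Σ; ∃; _×_; _,_)
open import Data.Sum using (_⊎_)
open import Relation.Nullary using (¬_)
open import Relation.Binary.Core using (Rel)
open import Relation.Binary.PropositionalEquality using (_≡_)

-- A finite poset is represented (up to isomorphism) as a partial order
-- on Fin n, with respect to propositional equality.
-- Subsets of P are represented by their (Boolean) characteristic maps.

Subset : ℕ → Set
Subset n = Fin n → Bool

_∈_ : ∀ {n} → Fin n → Subset n → Set
x ∈ S = S x ≡ true

_∉_ : ∀ {n} → Fin n → Subset n → Set
x ∉ S = S x ≡ false

module _ {n : ℕ} (_≼_ : Rel (Fin n) 0ℓ) where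

  IsUpperSet : Subset n → Set
  IsUpperSet U = ∀ x y → x ≼ y → x ∈ U → y ∈ U

  Nonempty : Subset n → Set
  Nonempty U = ∃ λ x → x ∈ U

  IsDisjointUpperSplit : Subset n → Subset n → Subset n → Set
  IsDisjointUpperSplit I U V =
    IsUpperSet U × IsUpperSet V × Nonempty U × Nonempty V
    × (∀ x → x ∈ U → x ∈ V → Data.Empty.⊥)
    × (∀ x → (x ∈ I → x ∈ U ⊎ x ∈ V) × (x ∈ U ⊎ x ∈ V → x ∈ I))
    where import Data.Empty

  IsIrreducibleUpperSet : Subset n → Set
  IsIrreducibleUpperSet I =
    Nonempty I × IsUpperSet I
    × ¬ (Σ (Subset n) λ U → Σ (Subset n) λ V → IsDisjointUpperSplit I U V)

  -- membership in M(P): monotone maps P → ℕ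
  IsMonotone : (Fin n → ℕ) → Set
  IsMonotone f = ∀ x y → x ≼ y → f x ≤ℕ f y

  -- f ≤_{M(P)} g  iff  g - f ∈ M(P), i.e. g = f + h for some h ∈ M(P)
  _≤M_ : (Fin n → ℕ) → (Fin n → ℕ) → Set
  f ≤M g = Σ (Fin n → ℕ) λ h → IsMonotone h × (∀ x → g x ≡ f x + h x)

  IsPrimeM : (Fin n → ℕ) → Set
  IsPrimeM a = ∀ b c → IsMonotone b → IsMonotone c →
    a ≤M (λ x → b x + c x) → a ≤M b ⊎ a ≤M c

  MeetsAbove : Fin n → Subset n → Set
  MeetsAbove x I = ∃ λ y → x ≼ y × y ∈ I

χ : ∀ {n} → Subset n → Fin n → ℕ
χ I x = if I x then 1 else 0

-- For monotone f, χ I ≤ f in M(P) exactly when f ≥ 1 on I and f increases strictly from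
-- every x ∉ I to every y ∈ I above it.  Primality is tested against sums of indicators of
-- upper sets.  Splitting I into ↑v and I ∖ {v} for a minimal v forces I = ↑v.  For a point
-- x of the lower boundary, χ I + χ ↑x = χ (I ∪ ↑x) + χ (I ∩ ↑x) and χ (I ∪ ↑x) does not
-- increase at x, so I ⊆ ↑x.  For lower boundary points a and b, χ ↑a + χ ↑b dominates χ I
-- unless a and b have a common upper bound in the lower boundary; so the lower boundary is
-- directed and, being finite, has a maximum.  Conversely, if I = ↑v and the lower boundary
-- lies below its maximum m, then χ I ≤ b + c gives b m + c m < b v + c v, so b or c already
-- increases strictly from m to v.

module Submission where

open import Defs
open import Level using (0ℓ)
open import Data.Nat using (ℕ; _+_; _∸_; _≤_; _<_; z≤n; s≤s; _<?_)
open import Data.Nat.Properties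
  using (≤-refl; ≤-trans; <-≤-trans; ≤-<-trans; +-mono-≤; m≤n+m; ≮⇒≥; <-irrefl; ∸-monoˡ-≤; m+[n∸m]≡n)
open import Data.Fin using (Fin; _≟_)
open import Data.Fin.Induction using (po-wellFounded)
open import Data.Fin.Properties using (any?)
open import Data.Bool using (true; false; _∨_; _∧_)
import Data.Bool as Bool
open import Data.Product using (Σ; ∃; _×_; _,_; proj₁; proj₂)
open import Data.Sum using (_⊎_; inj₁; inj₂)
import Data.Sum as Sum
open import Data.Empty using (⊥-elim)
open import Function using (flip)
open import Function.Bundles using (_⇔_; mk⇔)
open import Induction.WellFounded using (Acc; acc)
open import Relation.Nullary using (¬_; Dec; yes; no)
open import Relation.Nullary.Decidable using (does; toSum; dec-true; decidable-stable; _×-dec_; ¬?)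
open import Relation.Unary as U using (Pred)
open import Relation.Binary.Core using (Rel)
open import Relation.Binary.Definitions using (Decidable)
open import Relation.Binary.Structures using (IsPartialOrder)
open import Relation.Binary.PropositionalEquality using (_≡_; refl; sym; trans; subst)
import Relation.Binary.Construct.Flip.EqAndOrd as Flip
import Relation.Binary.Construct.NonStrictToStrict as ToStrict

m+n<o+p⇒m<o⊎n<p : ∀ {m n o p} → m + n < o + p → m < o ⊎ n < p
m+n<o+p⇒m<o⊎n<p {m} {n} {o} {p} m+n<o+p with m <? o | n <? p
... | yes m<o | _       = inj₁ m<o
... | no _    | yes n<p = inj₂ n<p
... | no m≮o  | no n≮p  =
  ⊥-elim (<-irrefl refl (<-≤-trans m+n<o+p (+-mono-≤ (≮⇒≥ m≮o) (≮⇒≥ n≮p))))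

minimal-element : ∀ {n} {_≼_ : Rel (Fin n) 0ℓ} → IsPartialOrder _≡_ _≼_ → Decidable _≼_ →
  {P : Pred (Fin n) 0ℓ} → U.Decidable P → ∃ P →
  ∃ λ m → P m × (∀ z → P z → z ≼ m → z ≡ m)
minimal-element {_≼_ = _≼_} isPO _≼?_ {P} P? (x , px) = go (po-wellFounded isPO x) px
  where
  go : ∀ {x} → Acc (ToStrict._<_ _≡_ _≼_) x → P x → ∃ λ m → P m × (∀ z → P z → z ≼ m → z ≡ m)
  go {x} (acc below) px with any? (λ z → P? z ×-dec ((z ≼? x) ×-dec ¬? (z ≟ x)))
  ... | yes (z , pz , z<x) = go (below z<x) pz
  ... | no  ∄smaller       = x , px , λ z pz z≼x →
    decidable-stable (z ≟ x) (λ z≢x → ∄smaller (z , pz , z≼x , z≢x))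

maximal-element : ∀ {n} {_≼_ : Rel (Fin n) 0ℓ} → IsPartialOrder _≡_ _≼_ → Decidable _≼_ →
  {P : Pred (Fin n) 0ℓ} → U.Decidable P → ∃ P →
  ∃ λ m → P m × (∀ z → P z → m ≼ z → z ≡ m)
maximal-element isPO _≼?_ = minimal-element (Flip.isPartialOrder isPO) (flip _≼?_)

directed⇒maximum : ∀ {n} {_≼_ : Rel (Fin n) 0ℓ} → IsPartialOrder _≡_ _≼_ → Decidable _≼_ →
  {P : Pred (Fin n) 0ℓ} → U.Decidable P → ∃ P →
  (∀ {a b} → P a → P b → ∃ λ w → P w × a ≼ w × b ≼ w) →
  ∃ λ m → P m × (∀ z → P z → z ≼ m)
directed⇒maximum {_≼_ = _≼_} isPO _≼?_ P? ∃P directed with maximal-element isPO _≼?_ P? ∃P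
... | m , pm , maximal = m , pm , λ z pz →
  let (w , pw , z≼w , m≼w) = directed pz pm in subst (z ≼_) (maximal w pw m≼w) z≼w

module _ {n : ℕ} where

  _∪_ _∩_ : Subset n → Subset n → Subset n
  (U ∪ V) z = U z ∨ V z
  (U ∩ V) z = U z ∧ V z

  infixr 30 _∪_ _∩_

  _∈?_ : (z : Fin n) (U : Subset n) → Dec (z ∈ U)
  z ∈? U = U z Bool.≟ true

  toSubset : {P : Pred (Fin n) 0ℓ} → U.Decidable P → Subset n
  toSubset P? z = does (P? z)

  ∈-toSubset⁺ : {P : Pred (Fin n) 0ℓ} (P? : U.Decidable P) {z : Fin n} → P z → z ∈ toSubset P?
  ∈-toSubset⁺ P? {z} = dec-true (P? z)

  ∈-toSubset⁻ : {P : Pred (Fin n) 0ℓ} (P? : U.Decidable P) {z : Fin n} → z ∈ toSubset P? → P z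
  ∈-toSubset⁻ P? {z} z∈P with P? z
  ... | yes pz = pz

  ∈-∪ˡ : ∀ (U V : Subset n) {z} → z ∈ U → z ∈ U ∪ V
  ∈-∪ˡ U V z∈U rewrite z∈U = refl

  ∈-∪ʳ : ∀ (U V : Subset n) {z} → z ∈ V → z ∈ U ∪ V
  ∈-∪ʳ U V {z} z∈V with U z
  ... | true  = refl
  ... | false = z∈V

  ∈-∪⁻ : ∀ (U V : Subset n) {z} → z ∈ U ∪ V → z ∈ U ⊎ z ∈ V
  ∈-∪⁻ U V {z} z∈U∪V with U z
  ... | true  = inj₁ refl
  ... | false = inj₂ z∈U∪V

  ∈-∩ : ∀ (U V : Subset n) {z} → z ∈ U → z ∈ V → z ∈ U ∩ V
  ∈-∩ U V z∈U z∈V rewrite z∈U = z∈V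

  ∈-∩⁻ˡ : ∀ (U V : Subset n) {z} → z ∈ U ∩ V → z ∈ U
  ∈-∩⁻ˡ U V {z} z∈U∩V with U z
  ... | true = refl

  ∈-∩⁻ʳ : ∀ (U V : Subset n) {z} → z ∈ U ∩ V → z ∈ V
  ∈-∩⁻ʳ U V {z} z∈U∩V with U z
  ... | true = z∈U∩V

  χ+χ≤1 : ∀ (U V : Subset n) {z} → ¬ (z ∈ U × z ∈ V) → χ U z + χ V z ≤ 1
  χ+χ≤1 U V {z} not-both with U z | V z
  ... | true  | true  = ⊥-elim (not-both (refl , refl))
  ... | true  | false = s≤s z≤n
  ... | false | true  = s≤s z≤n
  ... | false | false = z≤n

  χ-∪-∩ : ∀ (U V : Subset n) z → χ (U ∪ V) z + χ (U ∩ V) z ≡ χ U z + χ V z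
  χ-∪-∩ U V z with U z | V z
  ... | true  | true  = refl
  ... | true  | false = refl
  ... | false | true  = refl
  ... | false | false = refl

module UpperSets {n : ℕ} (_≼_ : Rel (Fin n) 0ℓ) where

  LowerBoundary : Subset n → Fin n → Set
  LowerBoundary I x = x ∉ I × MeetsAbove _≼_ x I

  IsPrincipal : Subset n → Fin n → Set
  IsPrincipal I v = ∀ x → (x ∈ I → v ≼ x) × (v ≼ x → x ∈ I)

  LowerBoundaryBelow : Subset n → Fin n → Set
  LowerBoundaryBelow I v = ∀ x → x ∉ I → MeetsAbove _≼_ x I → x ≼ v

  LowerBoundaryEmptyOrHasMaximum : Subset n → Set
  LowerBoundaryEmptyOrHasMaximum I =
    (∀ x → x ∉ I → ¬ MeetsAbove _≼_ x I)
    ⊎ Σ (Fin n) λ m → LowerBoundary I m × (∀ x → x ∉ I → MeetsAbove _≼_ x I → x ≼ m)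

  PrimeCriterion : Subset n → Set
  PrimeCriterion I =
    Σ (Fin n) λ v → IsPrincipal I v × LowerBoundaryBelow I v × LowerBoundaryEmptyOrHasMaximum I

  1≤χ⇒∈ : ∀ (U : Subset n) {z} → 1 ≤ χ U z → z ∈ U
  1≤χ⇒∈ U {z} 1≤χ with U z
  ... | true = refl

  χ-monotone : ∀ {U : Subset n} → IsUpperSet _≼_ U → IsMonotone _≼_ (χ U)
  χ-monotone {U} up x y x≼y with U x in x∈U
  ... | false = z≤n
  ... | true rewrite up x y x≼y x∈U = ≤-refl

  module _ {I : Subset n} where

    χ≤M-intro : ∀ {f} → IsUpperSet _≼_ I → IsMonotone _≼_ f →
      (∀ y → y ∈ I → 1 ≤ f y) →
      (∀ x y → x ∉ I → x ≼ y → y ∈ I → f x < f y) →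
      _≤M_ _≼_ (χ I) f
    χ≤M-intro {f} up f-mono f-pos f-jump = (λ x → f x ∸ χ I x) , rest-mono , split
      where
      split : ∀ x → f x ≡ χ I x + (f x ∸ χ I x)
      split x with I x in x∈I
      ... | true  = sym (m+[n∸m]≡n (f-pos x x∈I))
      ... | false = refl
      rest-mono : IsMonotone _≼_ (λ x → f x ∸ χ I x)
      rest-mono x y x≼y with I x in x∈I | I y in y∈I
      ... | true  | true  = ∸-monoˡ-≤ 1 (f-mono x y x≼y)
      ... | false | true  = ∸-monoˡ-≤ 1 (f-jump x y x∈I x≼y y∈I)
      ... | false | false = f-mono x y x≼y
      ... | true  | false with () ← trans (sym (up x y x≼y x∈I)) y∈I

    χ≤M⇒positive : ∀ {f} → _≤M_ _≼_ (χ I) f → ∀ y → y ∈ I → 1 ≤ f y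
    χ≤M⇒positive (_ , _ , split) y y∈I rewrite split y | y∈I = s≤s z≤n

    χ≤M⇒jump : ∀ {f} → _≤M_ _≼_ (χ I) f → ∀ x y → x ∉ I → x ≼ y → y ∈ I → f x < f y
    χ≤M⇒jump (h , h-mono , split) x y x∉I x≼y y∈I
      rewrite split x | split y | x∉I | y∈I = s≤s (h-mono x y x≼y)

    χ≤M-principal : ∀ {v f p} → IsUpperSet _≼_ I → (∀ y → y ∈ I → v ≼ y) → IsMonotone _≼_ f →
      (∀ x → LowerBoundary I x → f x ≤ p) → p < f v → _≤M_ _≼_ (χ I) f
    χ≤M-principal {v} {f} up I⊆↑v f-mono bounded p<fv = χ≤M-intro up f-mono
      (λ y y∈I → ≤-trans (≤-<-trans z≤n p<fv) (fv≤ y y∈I))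
      (λ x y x∉I x≼y y∈I →
         ≤-<-trans (bounded x (x∉I , y , x≼y , y∈I)) (<-≤-trans p<fv (fv≤ y y∈I)))
      where
      fv≤ : ∀ y → y ∈ I → f v ≤ f y
      fv≤ y y∈I = f-mono v y (I⊆↑v y y∈I)

    χ≤M-cover : ∀ {U V : Subset n} → IsUpperSet _≼_ I → IsUpperSet _≼_ U → IsUpperSet _≼_ V →
      (∀ z → z ∈ U ⊎ z ∈ V → z ∈ I) → (∀ z → z ∈ I → z ∈ U ⊎ z ∈ V) →
      _≤M_ _≼_ (χ I) (λ z → χ U z + χ V z)
    χ≤M-cover {U} {V} up U-up V-up ⊆I I⊆ = χ≤M-intro up
      (λ x y x≼y → +-mono-≤ (χ-monotone U-up x y x≼y) (χ-monotone V-up x y x≼y)) positive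
      (λ x y x∉I _ y∈I → subst (_< χ U y + χ V y) (sym (outside x∉I)) (positive y y∈I))
      where
      positive : ∀ y → y ∈ I → 1 ≤ χ U y + χ V y
      positive y y∈I with I⊆ y y∈I
      ... | inj₁ y∈U rewrite y∈U = s≤s z≤n
      ... | inj₂ y∈V rewrite y∈V = m≤n+m 1 (χ U y)
      outside : ∀ {x} → x ∉ I → χ U x + χ V x ≡ 0
      outside {x} x∉I with U x in x∈U | V x in x∈V
      ... | false | false = refl
      ... | true  | _     with () ← trans (sym (⊆I x (inj₁ x∈U))) x∉I
      ... | false | true  with () ← trans (sym (⊆I x (inj₂ x∈V))) x∉I

    χ≤Mχ⇒⊆ : ∀ (U : Subset n) → _≤M_ _≼_ (χ I) (χ U) → ∀ z → z ∈ I → z ∈ U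
    χ≤Mχ⇒⊆ U χI≤χU z z∈I = 1≤χ⇒∈ U (χ≤M⇒positive χI≤χU z z∈I)

    χ≤Mχ⇒∉ : ∀ {U : Subset n} → IsUpperSet _≼_ U → _≤M_ _≼_ (χ I) (χ U) →
      ∀ {x} → LowerBoundary I x → ¬ x ∈ U
    χ≤Mχ⇒∉ {U} U-up χI≤χU {x} (x∉I , y , x≼y , y∈I) x∈U
      with χ≤M⇒jump χI≤χU x y x∉I x≼y y∈I
    ... | χUx<χUy rewrite x∈U | U-up x y x≼y x∈U with s≤s () ← χUx<χUy

  ∪-upper : ∀ {U V : Subset n} → IsUpperSet _≼_ U → IsUpperSet _≼_ V → IsUpperSet _≼_ (U ∪ V)
  ∪-upper {U} {V} U-up V-up x y x≼y x∈U∪V with ∈-∪⁻ U V x∈U∪V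
  ... | inj₁ x∈U = ∈-∪ˡ U V (U-up x y x≼y x∈U)
  ... | inj₂ x∈V = ∈-∪ʳ U V (V-up x y x≼y x∈V)

  ∩-upper : ∀ {U V : Subset n} → IsUpperSet _≼_ U → IsUpperSet _≼_ V → IsUpperSet _≼_ (U ∩ V)
  ∩-upper {U} {V} U-up V-up x y x≼y x∈U∩V =
    ∈-∩ U V (U-up x y x≼y (∈-∩⁻ˡ U V x∈U∩V)) (V-up x y x≼y (∈-∩⁻ʳ U V x∈U∩V))

module FinitePosets {n : ℕ} {_≼_ : Rel (Fin n) 0ℓ}
  (isPO : IsPartialOrder _≡_ _≼_) (_≼?_ : Decidable _≼_) where

  open IsPartialOrder isPO using () renaming (refl to ≼-refl; trans to ≼-trans)
  open UpperSets _≼_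

  infix 30 ↑_

  ↑_ : Fin n → Subset n
  ↑ v = toSubset (v ≼?_)

  ∈-↑⁺ : ∀ {v z} → v ≼ z → z ∈ ↑ v
  ∈-↑⁺ {v} = ∈-toSubset⁺ (v ≼?_)

  ∈-↑⁻ : ∀ {v z} → z ∈ ↑ v → v ≼ z
  ∈-↑⁻ {v} = ∈-toSubset⁻ (v ≼?_)

  ↑-upper : ∀ v → IsUpperSet _≼_ (↑ v)
  ↑-upper v x y x≼y x∈↑v = ∈-↑⁺ (≼-trans (∈-↑⁻ x∈↑v) x≼y)

  lowerBoundary? : (I : Subset n) → U.Decidable (LowerBoundary I)
  lowerBoundary? I x = (I x Bool.≟ false) ×-dec any? (λ y → (x ≼? y) ×-dec (y ∈? I))

  criterion⇒prime : ∀ {I} → IsUpperSet _≼_ I → PrimeCriterion I → IsPrimeM _≼_ (χ I)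
  criterion⇒prime {I} up (v , principal , below-v , shape) b c b-mono c-mono χI≤b+c =
    Sum.[ (λ empty → split {0} {0} (χ≤M⇒positive χI≤b+c v v∈I) (vacuous empty) (vacuous empty))
        , (λ (m , (m∉I , m-meets) , maximum) →
             split (χ≤M⇒jump χI≤b+c m v m∉I (below-v m m∉I m-meets) v∈I)
                   (λ x (x∉I , meets) → b-mono x m (maximum x x∉I meets))
                   (λ x (x∉I , meets) → c-mono x m (maximum x x∉I meets)))
        ] shape
    where
    v∈I : v ∈ I
    v∈I = proj₂ (principal v) ≼-refl
    I⊆↑v : ∀ y → y ∈ I → v ≼ y
    I⊆↑v y = proj₁ (principal y)
    vacuous : (∀ x → x ∉ I → ¬ MeetsAbove _≼_ x I) →
      ∀ {f : Fin n → ℕ} x → LowerBoundary I x → f x ≤ 0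
    vacuous empty x (x∉I , meets) = ⊥-elim (empty x x∉I meets)
    split : ∀ {p q} → p + q < b v + c v →
      (∀ x → LowerBoundary I x → b x ≤ p) → (∀ x → LowerBoundary I x → c x ≤ q) →
      _≤M_ _≼_ (χ I) b ⊎ _≤M_ _≼_ (χ I) c
    split p+q<bv+cv b≤p c≤q =
      Sum.map (χ≤M-principal up I⊆↑v b-mono b≤p) (χ≤M-principal up I⊆↑v c-mono c≤q)
              (m+n<o+p⇒m<o⊎n<p p+q<bv+cv)

  module _ {I : Subset n} (up : IsUpperSet _≼_ I) (prime : IsPrimeM _≼_ (χ I)) where

    prime⇒above-minimal : ∀ {v} → v ∈ I → (∀ z → z ∈ I → z ≼ v → z ≡ v) → ∀ z → z ∈ I → v ≼ z
    prime⇒above-minimal {v} v∈I minimal =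
      conclude (prime (χ (↑ v)) (χ I∖v) (χ-monotone (↑-upper v)) (χ-monotone I∖v-upper)
                      (χ≤M-cover up (↑-upper v) I∖v-upper ⊆I I⊆))
      where
      I∖v-member? : U.Decidable (λ z → z ∈ I × ¬ z ≡ v)
      I∖v-member? z = (z ∈? I) ×-dec ¬? (z ≟ v)
      I∖v : Subset n
      I∖v = toSubset I∖v-member?
      I∖v-upper : IsUpperSet _≼_ I∖v
      I∖v-upper x y x≼y x∈I∖v with ∈-toSubset⁻ I∖v-member? x∈I∖v
      ... | x∈I , x≢v =
        ∈-toSubset⁺ I∖v-member? (up x y x≼y x∈I , λ { refl → x≢v (minimal x x∈I x≼y) })
      ⊆I : ∀ z → z ∈ ↑ v ⊎ z ∈ I∖v → z ∈ I
      ⊆I z (inj₁ z∈↑v)  = up v z (∈-↑⁻ z∈↑v) v∈I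
      ⊆I z (inj₂ z∈I∖v) = proj₁ (∈-toSubset⁻ I∖v-member? z∈I∖v)
      I⊆ : ∀ z → z ∈ I → z ∈ ↑ v ⊎ z ∈ I∖v
      I⊆ z z∈I = Sum.map (λ { refl → ∈-↑⁺ ≼-refl })
                         (λ z≢v → ∈-toSubset⁺ I∖v-member? (z∈I , z≢v))
                         (toSum (z ≟ v))
      conclude : _≤M_ _≼_ (χ I) (χ (↑ v)) ⊎ _≤M_ _≼_ (χ I) (χ I∖v) → ∀ z → z ∈ I → v ≼ z
      conclude (inj₁ χI≤χ↑v) z z∈I = ∈-↑⁻ (χ≤Mχ⇒⊆ (↑ v) χI≤χ↑v z z∈I)
      conclude (inj₂ χI≤χI∖v) =
        ⊥-elim (proj₂ (∈-toSubset⁻ I∖v-member? (χ≤Mχ⇒⊆ I∖v χI≤χI∖v v v∈I)) refl)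

    prime⇒above-lowerBoundary : ∀ {x} → LowerBoundary I x → ∀ z → z ∈ I → x ≼ z
    prime⇒above-lowerBoundary {x} x∈∂I =
      conclude (prime (χ (I ∪ ↑ x)) (χ (I ∩ ↑ x)) (χ-monotone I∪↑x-upper)
                      (χ-monotone (∩-upper up (↑-upper x))) χI≤χI∪↑x+χI∩↑x)
      where
      I∪↑x-upper : IsUpperSet _≼_ (I ∪ ↑ x)
      I∪↑x-upper = ∪-upper up (↑-upper x)
      χI≤χI∪↑x+χI∩↑x : _≤M_ _≼_ (χ I) (λ z → χ (I ∪ ↑ x) z + χ (I ∩ ↑ x) z)
      χI≤χI∪↑x+χI∩↑x = χ (↑ x) , χ-monotone (↑-upper x) , χ-∪-∩ I (↑ x)
      conclude : _≤M_ _≼_ (χ I) (χ (I ∪ ↑ x)) ⊎ _≤M_ _≼_ (χ I) (χ (I ∩ ↑ x)) → ∀ z → z ∈ I → x ≼ z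
      conclude (inj₁ χI≤χI∪↑x) =
        ⊥-elim (χ≤Mχ⇒∉ I∪↑x-upper χI≤χI∪↑x x∈∂I (∈-∪ʳ I (↑ x) (∈-↑⁺ ≼-refl)))
      conclude (inj₂ χI≤χI∩↑x) z z∈I = ∈-↑⁻ (∈-∩⁻ʳ I (↑ x) (χ≤Mχ⇒⊆ (I ∩ ↑ x) χI≤χI∩↑x z z∈I))

    prime⇒lowerBoundary-directed : ∀ {a b} → LowerBoundary I a → LowerBoundary I b →
      ∃ λ w → LowerBoundary I w × a ≼ w × b ≼ w
    prime⇒lowerBoundary-directed {a} {b} a∈∂I b∈∂I
      with any? (λ w → lowerBoundary? I w ×-dec ((a ≼? w) ×-dec (b ≼? w)))
    ... | yes upper-bound = upper-bound
    ... | no  ∄upper-bound = ⊥-elim (Sum.[ ∂I∌ a∈∂I , ∂I∌ b∈∂I ]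
            (prime (χ (↑ a)) (χ (↑ b)) (χ-monotone (↑-upper a)) (χ-monotone (↑-upper b)) χI≤χ↑a+χ↑b))
      where
      ∂I∌ : ∀ {x} → LowerBoundary I x → ¬ _≤M_ _≼_ (χ I) (χ (↑ x))
      ∂I∌ x∈∂I χI≤χ↑x = χ≤Mχ⇒∉ (↑-upper _) χI≤χ↑x x∈∂I (∈-↑⁺ ≼-refl)
      both : ∀ y → y ∈ I → χ (↑ a) y + χ (↑ b) y ≡ 2
      both y y∈I
        rewrite ∈-↑⁺ {a} (prime⇒above-lowerBoundary a∈∂I y y∈I)
              | ∈-↑⁺ {b} (prime⇒above-lowerBoundary b∈∂I y y∈I) = refl
      χI≤χ↑a+χ↑b : _≤M_ _≼_ (χ I) (λ z → χ (↑ a) z + χ (↑ b) z)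
      χI≤χ↑a+χ↑b = χ≤M-intro up
        (λ x y x≼y → +-mono-≤ (χ-monotone (↑-upper a) x y x≼y) (χ-monotone (↑-upper b) x y x≼y))
        (λ y y∈I → subst (1 ≤_) (sym (both y y∈I)) (s≤s z≤n))
        (λ w y w∉I w≼y y∈I → subst (χ (↑ a) w + χ (↑ b) w <_) (sym (both y y∈I))
           (s≤s (χ+χ≤1 (↑ a) (↑ b) λ (w∈↑a , w∈↑b) →
              ∄upper-bound (w , (w∉I , y , w≼y , y∈I) , ∈-↑⁻ w∈↑a , ∈-↑⁻ w∈↑b))))

  prime⇒criterion : ∀ {I} → IsUpperSet _≼_ I → Nonempty _≼_ I → IsPrimeM _≼_ (χ I) →
    PrimeCriterion I
  prime⇒criterion {I} up nonempty prime with minimal-element isPO _≼?_ (_∈? I) nonempty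
  ... | v , v∈I , minimal = v , principal , below-v , shape (any? (lowerBoundary? I))
    where
    principal : IsPrincipal I v
    principal x = prime⇒above-minimal up prime v∈I minimal x , λ v≼x → up v x v≼x v∈I
    below-v : LowerBoundaryBelow I v
    below-v x x∉I meets = prime⇒above-lowerBoundary up prime (x∉I , meets) v v∈I
    shape : Dec (∃ (LowerBoundary I)) → LowerBoundaryEmptyOrHasMaximum I
    shape (no ∄∂I) = inj₁ λ x x∉I meets → ∄∂I (x , x∉I , meets)
    shape (yes ∃∂I)
      with directed⇒maximum isPO _≼?_ (lowerBoundary? I) ∃∂I (prime⇒lowerBoundary-directed up prime)
    ... | m , m∈∂I , maximum = inj₂ (m , m∈∂I , λ x x∉I meets → maximum x (x∉I , meets))

theorem17 : (n : ℕ) (_≼_ : Rel (Fin n) 0ℓ) → IsPartialOrder _≡_ _≼_ → Decidable _≼_ →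
    (I : Subset n) → IsIrreducibleUpperSet _≼_ I →
    IsPrimeM _≼_ (χ I) ⇔
      Σ (Fin n) (λ v →
        (∀ x → (x ∈ I → v ≼ x) × (v ≼ x → x ∈ I))
        × (∀ x → x ∉ I → MeetsAbove _≼_ x I → x ≼ v)
        × ((∀ x → x ∉ I → ¬ MeetsAbove _≼_ x I)
           ⊎ Σ (Fin n) (λ m → (m ∉ I × MeetsAbove _≼_ m I)
               × (∀ x → x ∉ I → MeetsAbove _≼_ x I → x ≼ m))))
theorem17 n _≼_ isPO _≼?_ I (nonempty , up , _) =
  mk⇔ (prime⇒criterion up nonempty) (criterion⇒prime up)
  where open FinitePosets isPO _≼?_
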